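{- Let $B,Z,K$ be complex numbers with $K\ne0$ and $B\notin\{ -1,-2,-3,\dots\}$, and let $(v_n)_{n\ge0}$ satisfy $(n+B)v_{n+1}=Znv_n+K(B-n)v_{n-1}$ for all $n\ge1$. Then for all $n\ge0$, $$v_{n+1}=\frac{P_n(B,Z,K)}{(B+1)_n}v_1+\frac{Q_n(B,Z,K)}{(B+1)_n}v_0,$$ where, with $\Lambda_i=\Lambda_i(B)=(B-i)_i(B)_i=\prod_{m=-i}^{i-1}(B+m)$, $$P_n=\sum_{j=0}^{\lfloor n/2\rfloor}(-1)^jK^{n-j}(Z/K)^{n-2j}\frac{(n-j)!}{(n-2j)!}\sum_{i=0}^{j}\frac{(-1)^i(n-i)!}{i!^2(j-i)!}\Lambda_i,$$ $$Q_n=(B-1)\sum_{j=0}^{\lfloor(n-1)/2\rfloor}(-1)^jK^{n-j}(Z/K)^{n-2j-1}\frac{(n-j-1)!}{(n-2j-1)!}\sum_{i=0}^{j}\frac{(-1)^i(n-i)!}{i!(i+1)!(j-i)!}\Lambda_i.$$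
   Context: $(a)_n=a(a+1)\cdots(a+n-1)$ denotes the rising Pochhammer symbol, with $(a)_0=1$; an empty sum is $0$. -}

module Defs where

open import Level using (Level; _⊔_)
open import Data.Nat as ℕ using (ℕ; zero; suc; _∸_; _/_)
open import Data.Nat.Base using (_!)
open import Relation.Nullary using (¬_)
open import Algebra.Bundles using (CommutativeRing)

-- A field of characteristic zero, presented as a commutative ring with a
-- total inverse operation that is a genuine inverse on non-zero elements
-- (the value at 0 is irrelevant), and such that 1 + 1 + ... + 1 (n+1 times)
-- is never 0.  The complex numbers are the intended instance.
-- embedding of ℕ into a ring: ιR n = 1# + ... + 1# (n times)
ιR : ∀ {c ℓ} (R : CommutativeRing c ℓ) → ℕ → CommutativeRing.Carrier R
ιR R zero    = CommutativeRing.0# R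
ιR R (suc n) = CommutativeRing._+_ R (CommutativeRing.1# R) (ιR R n)

record CharZeroField (c ℓ : Level) : Set (Level.suc (c ⊔ ℓ)) where
  field
    commutativeRing : CommutativeRing c ℓ
  open CommutativeRing commutativeRing public
  ι : ℕ → Carrier
  ι = ιR commutativeRing
  field
    _⁻¹      : Carrier → Carrier
    ⁻¹-cong  : ∀ {x y} → x ≈ y → x ⁻¹ ≈ y ⁻¹
    inverse  : ∀ x → ¬ (x ≈ 0#) → x * x ⁻¹ ≈ 1#
    charZero : ∀ n → ¬ (ι (suc n) ≈ 0#)

module FieldOps {c ℓ : Level} (F : CharZeroField c ℓ) where
  open CharZeroField F

  pow : Carrier → ℕ → Carrier
  pow x zero    = 1#
  pow x (suc n) = pow x n * x

  poch : Carrier → ℕ → Carrier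
  poch a zero    = 1#
  poch a (suc n) = poch a n * (a + ι n)

  sumBelow : ℕ → (ℕ → Carrier) → Carrier
  sumBelow zero    f = 0#
  sumBelow (suc n) f = sumBelow n f + f n

  sumTo : ℕ → (ℕ → Carrier) → Carrier
  sumTo n f = sumBelow (suc n) f

  sgn : ℕ → Carrier
  sgn k = pow (- 1#) k

  -- rational number a / b with a, b natural (b = product of factorials, > 0)
  frac : ℕ → ℕ → Carrier
  frac a b = ι a * (ι b) ⁻¹

  Λ : Carrier → ℕ → Carrier
  Λ B i = poch (B - ι i) i * poch B i

  P : Carrier → Carrier → Carrier → ℕ → Carrier
  P B Z K n =
    sumTo (n / 2) λ j →
      sgn j * pow K (n ∸ j) * pow (Z * K ⁻¹) (n ∸ 2 ℕ.* j)
        * frac ((n ∸ j) !) ((n ∸ 2 ℕ.* j) !)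
        * sumTo j (λ i →
            sgn i * frac ((n ∸ i) !) (i ! ℕ.* i ! ℕ.* (j ∸ i) !) * Λ B i)

  -- Q_n(B,Z,K); the outer sum runs over 0 ≤ j ≤ ⌊(n-1)/2⌋, i.e. over the
  -- ⌊(n+1)/2⌋ values j < ⌊(n+1)/2⌋ (empty for n = 0).
  Q : Carrier → Carrier → Carrier → ℕ → Carrier
  Q B Z K n =
    (B - 1#) *
    sumBelow (suc n / 2) λ j →
      sgn j * pow K (n ∸ j) * pow (Z * K ⁻¹) (n ∸ 2 ℕ.* j ∸ 1)
        * frac ((n ∸ j ∸ 1) !) ((n ∸ 2 ℕ.* j ∸ 1) !)
        * sumTo j (λ i →
            sgn i * frac ((n ∸ i) !) (i ! ℕ.* (suc i) ! ℕ.* (j ∸ i) !) * Λ B i)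

{-# OPTIONS --safe #-}
-- Put wₙ = (B + 1)ₙ vₙ₊₁. The recurrence for v turns into the three-term recurrence
--   wₙ₊₂ = Z (n + 2) wₙ₊₁ + K (B - n - 2) (B + n + 1) wₙ,
-- with w₀ = v₁ and w₁ = Z v₁ + (B - 1) K v₀, so it suffices that Pₙ and Qₙ satisfy it with
-- (P₀, P₁) = (1, Z) and (Q₀, Q₁) = (0, (B - 1) K).
-- In the (j, i) summand of P (e = 0) and of Q / (B - 1) (e = 1) put s = j - i and r = n - 2j - e;
-- it becomes γₑ(i, s, r) (-1)ˢ Zʳ Kⁱ⁺ˢ⁺ᵉ Λᵢ with γₑ(i, s, r) = (i+s+r)! (e+i+2s+r)! / (r! i! (e+i)! s!).
-- Lowering r, i or s by one divides the monomial by Z, by K (B - i) (B + i - 1) or by -K, and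
-- (B - N) (B + N - 1) = (B - i - 1) (B + i) - (N (N - 1) - i (i + 1)), so the recurrence holds
-- summand by summand once γ satisfies the contiguity relation
--   γ(i, s, r) = N γ(i, s, r - 1) + γ(i - 1, s, r) + (N (N - 1) - i (i + 1)) γ(i, s - 1, r)
-- for N = 2 (i + s) + e + r ≥ 2. Since N (N - 1) - i (i + 1) = (N + i) (N - 1 - i), each
-- neighbour of γ(i, s, r) is an explicit rational multiple of it, and the relation reduces to
-- an identity between these ratios.

module Submission where

open import Defs
open import Level using (Level)
open import Algebra.Bundles using (CommutativeRing)
import Algebra.Solver.Ring as RingSolver
import Algebra.Solver.Ring.AlmostCommutativeRing as ACR
open import Data.Maybe using (Maybe; just; nothing)
open import Data.Nat using (ℕ; zero; suc)
import Data.Nat as ℕ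
import Data.Nat.DivMod as ℕ
import Data.Nat.Properties as ℕ
open import Data.Nat.Tactic.RingSolver using () renaming (solve-∀ to ℕ-solve-∀)
open import Data.Sum using (_⊎_; inj₁; inj₂)
open import Function.Bundles using (_⇔_; mk⇔; Equivalence)
open import Relation.Binary.PropositionalEquality as ≡ using (_≡_)
open import Relation.Nullary using (¬_; yes; no; contradiction)

module IntegerRingSolver {c ℓ} (R : CommutativeRing c ℓ) where
  open CommutativeRing R
  open import Algebra.Properties.Ring ring using (-‿distribˡ-*; -‿distribʳ-*; -‿involutive; -0#≈0#)
  open import Algebra.Properties.AbelianGroup +-abelianGroup using (⁻¹-∙-comm; xyx⁻¹≈y)
  open import Algebra.Properties.Monoid.Mult +-monoid using (_×_; ×-homo-+)
  open import Algebra.Properties.Monoid.Mult.TCOptimised +-monoid using (×ᵤ≈×) renaming (_×_ to _×′_)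
  open import Algebra.Properties.Semiring.Mult semiring using (×1-homo-*)
  open import Data.Integer as ℤ using (ℤ; +_; -[1+_]; sign; ∣_∣; _◃_; _⊖_)
  import Data.Integer.Properties as ℤ
  open import Data.Sign as Sign using (Sign)
  open import Relation.Binary.Reasoning.Setoid setoid

  private
    ι : ℕ → Carrier
    ι = ιR R

  ι≡×1 : ∀ n → ι n ≡ n × 1#
  ι≡×1 zero    = ≡.refl
  ι≡×1 (suc n) = ≡.cong (_+_ 1#) (ι≡×1 n)

  ι-homo-+ : ∀ m n → ι (m ℕ.+ n) ≈ ι m + ι n
  ι-homo-+ m n rewrite ι≡×1 (m ℕ.+ n) | ι≡×1 m | ι≡×1 n = ×-homo-+ 1# m n

  ι-homo-* : ∀ m n → ι (m ℕ.* n) ≈ ι m * ι n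
  ι-homo-* m n rewrite ι≡×1 (m ℕ.* n) | ι≡×1 m | ι≡×1 n = ×1-homo-* m n

  signed : Sign → Carrier → Carrier
  signed Sign.+ x = x
  signed Sign.- x = - x

  signed-cong : ∀ s {x y} → x ≈ y → signed s x ≈ signed s y
  signed-cong Sign.+ x≈y = x≈y
  signed-cong Sign.- x≈y = -‿cong x≈y

  signed-* : ∀ s t x y → signed (s Sign.* t) (x * y) ≈ signed s x * signed t y
  signed-* Sign.+ Sign.+ x y = refl
  signed-* Sign.+ Sign.- x y = -‿distribʳ-* x y
  signed-* Sign.- Sign.+ x y = -‿distribˡ-* x y
  signed-* Sign.- Sign.- x y = begin
    x * y             ≈⟨ -‿involutive (x * y) ⟨
    - (- (x * y))     ≈⟨ -‿cong (-‿distribˡ-* x y) ⟩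
    - (- x * y)       ≈⟨ -‿distribʳ-* (- x) y ⟩
    - x * - y         ∎

  ιℤ : ℤ → Carrier
  ιℤ i = signed (sign i) (ι ∣ i ∣)

  ιℤ-◃ : ∀ s n → ιℤ (s ◃ n) ≈ signed s (ι n)
  ιℤ-◃ Sign.+ zero    = refl
  ιℤ-◃ Sign.- zero    = sym -0#≈0#
  ιℤ-◃ Sign.+ (suc n) = refl
  ιℤ-◃ Sign.- (suc n) = refl

  ιℤ-⊖ : ∀ m n → ιℤ (m ⊖ n) ≈ ι m - ι n
  ιℤ-⊖ m       zero    = trans (sym (+-identityʳ (ι m))) (+-congˡ (sym -0#≈0#))
  ιℤ-⊖ zero    (suc n) = sym (+-identityˡ _)
  ιℤ-⊖ (suc m) (suc n) = begin
    ιℤ (suc m ⊖ suc n)                 ≡⟨ ≡.cong ιℤ (ℤ.[1+m]⊖[1+n]≡m⊖n m n) ⟩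
    ιℤ (m ⊖ n)                         ≈⟨ ιℤ-⊖ m n ⟩
    ι m - ι n                          ≈⟨ xyx⁻¹≈y 1# (ι m - ι n) ⟨
    1# + (ι m - ι n) - 1#              ≈⟨ +-congʳ (+-assoc 1# (ι m) (- ι n)) ⟨
    1# + ι m - ι n - 1#                ≈⟨ +-assoc (1# + ι m) (- ι n) (- 1#) ⟩
    1# + ι m + (- ι n - 1#)            ≈⟨ +-congˡ (+-comm (- ι n) (- 1#)) ⟩
    1# + ι m + (- 1# - ι n)            ≈⟨ +-congˡ (⁻¹-∙-comm 1# (ι n)) ⟩
    ι (suc m) - ι (suc n)              ∎

  ιℤ-+ : ∀ i j → ιℤ (i ℤ.+ j) ≈ ιℤ i + ιℤ j
  ιℤ-+ (+ m)    (+ n)    = ι-homo-+ m n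
  ιℤ-+ (+ m)    -[1+ n ] = ιℤ-⊖ m (suc n)
  ιℤ-+ -[1+ m ] (+ n)    = trans (ιℤ-⊖ n (suc m)) (+-comm _ _)
  ιℤ-+ -[1+ m ] -[1+ n ] = begin
    - ι (suc (suc (m ℕ.+ n)))          ≡⟨ ≡.cong (λ k → - ι (suc k)) (ℕ.+-suc m n) ⟨
    - ι (suc m ℕ.+ suc n)              ≈⟨ -‿cong (ι-homo-+ (suc m) (suc n)) ⟩
    - (ι (suc m) + ι (suc n))          ≈⟨ ⁻¹-∙-comm _ _ ⟨
    - ι (suc m) - ι (suc n)            ∎

  ιℤ-* : ∀ i j → ιℤ (i ℤ.* j) ≈ ιℤ i * ιℤ j
  ιℤ-* i j = begin
    ιℤ (sign i Sign.* sign j ◃ ∣ i ∣ ℕ.* ∣ j ∣)         ≈⟨ ιℤ-◃ (sign i Sign.* sign j) (∣ i ∣ ℕ.* ∣ j ∣) ⟩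
    signed (sign i Sign.* sign j) (ι (∣ i ∣ ℕ.* ∣ j ∣)) ≈⟨ signed-cong (sign i Sign.* sign j) (ι-homo-* ∣ i ∣ ∣ j ∣) ⟩
    signed (sign i Sign.* sign j) (ι ∣ i ∣ * ι ∣ j ∣)   ≈⟨ signed-* (sign i) (sign j) _ _ ⟩
    ιℤ i * ιℤ j                                       ∎

  ιℤ-neg : ∀ i → ιℤ (ℤ.- i) ≈ - ιℤ i
  ιℤ-neg -[1+ n ]  = sym (-‿involutive _)
  ιℤ-neg (+ zero)  = sym -0#≈0#
  ιℤ-neg (+ suc n) = refl

  -- The solver evaluates integer constants through the optimised _×′_, so that the
  -- constant 1 denotes 1# itself rather than ι 1 = 1# + 0#.
  fromℤ : ℤ → Carrier
  fromℤ i = signed (sign i) (∣ i ∣ ×′ 1#)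

  fromℤ≈ιℤ : ∀ i → fromℤ i ≈ ιℤ i
  fromℤ≈ιℤ i = signed-cong (sign i) (begin
    ∣ i ∣ ×′ 1#    ≈⟨ ×ᵤ≈× ∣ i ∣ 1# ⟨
    ∣ i ∣ × 1#     ≡⟨ ι≡×1 ∣ i ∣ ⟨
    ι ∣ i ∣        ∎)

  fromℤ-morphism : ℤ.+-*-rawRing ACR.-Raw-AlmostCommutative⟶ ACR.fromCommutativeRing R
  fromℤ-morphism = record
    { ⟦_⟧    = fromℤ
    ; +-homo = λ i j → transport (i ℤ.+ j) (trans (ιℤ-+ i j) (sym (+-cong (fromℤ≈ιℤ i) (fromℤ≈ιℤ j))))
    ; *-homo = λ i j → transport (i ℤ.* j) (trans (ιℤ-* i j) (sym (*-cong (fromℤ≈ιℤ i) (fromℤ≈ιℤ j))))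
    ; -‿homo = λ i → transport (ℤ.- i) (trans (ιℤ-neg i) (sym (-‿cong (fromℤ≈ιℤ i))))
    ; 0-homo = refl
    ; 1-homo = refl
    }
    where
    transport : ∀ i {x} → ιℤ i ≈ x → fromℤ i ≈ x
    transport i = trans (fromℤ≈ιℤ i)

  fromℤ-≟ : ∀ i j → Maybe (fromℤ i ≈ fromℤ j)
  fromℤ-≟ i j with i ℤ.≟ j
  ... | yes ≡.refl = just refl
  ... | no _       = nothing

  open RingSolver ℤ.+-*-rawRing (ACR.fromCommutativeRing R) fromℤ-morphism fromℤ-≟ public
    using (solve; _:=_; con; _:+_; _:*_; :-_; _:-_)

module FieldFacts {c ℓ} (F : CharZeroField c ℓ) where
  open CharZeroField F
  open FieldOps F
  open IntegerRingSolver commutativeRing public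
    using (ι-homo-+; ι-homo-*; solve; _:=_; con; _:+_; _:*_; :-_; _:-_)
  open import Relation.Binary.Reasoning.Setoid setoid

  ⁻¹-inverseˡ : ∀ {x} → ¬ x ≈ 0# → x ⁻¹ * x ≈ 1#
  ⁻¹-inverseˡ {x} x≉0 = trans (*-comm (x ⁻¹) x) (inverse x x≉0)

  *-cancelˡ : ∀ {x a b} → ¬ x ≈ 0# → x * a ≈ x * b → a ≈ b
  *-cancelˡ {x} {a} {b} x≉0 xa≈xb = begin
    a                ≈⟨ *-identityˡ a ⟨
    1# * a           ≈⟨ *-congʳ (⁻¹-inverseˡ x≉0) ⟨
    x ⁻¹ * x * a     ≈⟨ *-assoc (x ⁻¹) x a ⟩
    x ⁻¹ * (x * a)   ≈⟨ *-congˡ xa≈xb ⟩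
    x ⁻¹ * (x * b)   ≈⟨ *-assoc (x ⁻¹) x b ⟨
    x ⁻¹ * x * b     ≈⟨ *-congʳ (⁻¹-inverseˡ x≉0) ⟩
    1# * b           ≈⟨ *-identityˡ b ⟩
    b                ∎

  *-nonzero : ∀ {x y} → ¬ x ≈ 0# → ¬ y ≈ 0# → ¬ x * y ≈ 0#
  *-nonzero {x} x≉0 y≉0 xy≈0 = y≉0 (*-cancelˡ x≉0 (trans xy≈0 (sym (zeroʳ x))))

  ι-nonzero : ∀ n → {{ℕ.NonZero n}} → ¬ ι n ≈ 0#
  ι-nonzero (suc n) = charZero n

  1≉0 : ¬ 1# ≈ 0#
  1≉0 1≈0 = charZero 0 (trans (+-identityʳ 1#) 1≈0)

  frac-*-denominator : ∀ a b → {{ℕ.NonZero b}} → frac a b * ι b ≈ ι a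
  frac-*-denominator a b = begin
    ι a * ι b ⁻¹ * ι b     ≈⟨ *-assoc (ι a) (ι b ⁻¹) (ι b) ⟩
    ι a * (ι b ⁻¹ * ι b)   ≈⟨ *-congˡ (⁻¹-inverseˡ (ι-nonzero b)) ⟩
    ι a * 1#               ≈⟨ *-identityʳ (ι a) ⟩
    ι a                    ∎

  frac-unique : ∀ {x} a b → {{ℕ.NonZero b}} → x * ι b ≈ ι a → x ≈ frac a b
  frac-unique {x} a b xb≈a = begin
    x                        ≈⟨ *-identityʳ x ⟨
    x * 1#                   ≈⟨ *-congˡ (inverse (ι b) (ι-nonzero b)) ⟨
    x * (ι b * ι b ⁻¹)       ≈⟨ *-assoc x (ι b) (ι b ⁻¹) ⟨
    x * ι b * ι b ⁻¹         ≈⟨ *-congʳ xb≈a ⟩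
    frac a b                 ∎

  frac-* : ∀ a b c d → {{_ : ℕ.NonZero b}} {{_ : ℕ.NonZero d}} →
           frac a b * frac c d ≈ frac (a ℕ.* c) (b ℕ.* d)
  frac-* a b c d = frac-unique (a ℕ.* c) (b ℕ.* d) {{ℕ.m*n≢0 b d}} (begin
    frac a b * frac c d * ι (b ℕ.* d)          ≈⟨ *-congˡ (ι-homo-* b d) ⟩
    frac a b * frac c d * (ι b * ι d)          ≈⟨ solve 4 (λ x y u v → x :* y :* (u :* v) := x :* u :* (y :* v)) refl
                                                    (frac a b) (frac c d) (ι b) (ι d) ⟩
    frac a b * ι b * (frac c d * ι d)          ≈⟨ *-cong (frac-*-denominator a b) (frac-*-denominator c d) ⟩
    ι a * ι c                                  ≈⟨ ι-homo-* a c ⟨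
    ι (a ℕ.* c)                                ∎)

  frac-cross : ∀ m a b m′ a′ b′ → {{_ : ℕ.NonZero b}} {{_ : ℕ.NonZero b′}} →
               m ℕ.* a ℕ.* b′ ≡ m′ ℕ.* a′ ℕ.* b → ι m * frac a b ≈ ι m′ * frac a′ b′
  frac-cross m a b m′ a′ b′ eq = *-cancelˡ (*-nonzero (ι-nonzero b) (ι-nonzero b′)) (begin
    ι b * ι b′ * (ι m * frac a b)        ≈⟨ solve 5 (λ u u′ x y f → u :* u′ :* (x :* f) := x :* (f :* u) :* u′) refl
                                              (ι b) (ι b′) (ι m) (ι a) (frac a b) ⟩
    ι m * (frac a b * ι b) * ι b′        ≈⟨ *-congʳ (*-congˡ (frac-*-denominator a b)) ⟩
    ι m * ι a * ι b′                     ≈⟨ ι-product m a b′ ⟨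
    ι (m ℕ.* a ℕ.* b′)                   ≡⟨ ≡.cong ι eq ⟩
    ι (m′ ℕ.* a′ ℕ.* b)                  ≈⟨ ι-product m′ a′ b ⟩
    ι m′ * ι a′ * ι b                    ≈⟨ *-congʳ (*-congˡ (frac-*-denominator a′ b′)) ⟨
    ι m′ * (frac a′ b′ * ι b′) * ι b     ≈⟨ solve 5 (λ u u′ x y f → x :* (f :* u′) :* u := u :* u′ :* (x :* f)) refl
                                              (ι b) (ι b′) (ι m′) (ι a′) (frac a′ b′) ⟩
    ι b * ι b′ * (ι m′ * frac a′ b′)     ∎)
    where
    ι-product : ∀ x y z → ι (x ℕ.* y ℕ.* z) ≈ ι x * ι y * ι z
    ι-product x y z = trans (ι-homo-* (x ℕ.* y) z) (*-congʳ (ι-homo-* x y))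

  frac-scaled : ∀ u v a b → {{_ : ℕ.NonZero b}} {{_ : ℕ.NonZero (v ℕ.* b)}} →
                ι u * frac a b ≈ ι v * frac (u ℕ.* a) (v ℕ.* b)
  frac-scaled u v a b = frac-cross u a b v (u ℕ.* a) (v ℕ.* b) (rearrange u v a b)
    where
    rearrange : ∀ u v a b → u ℕ.* a ℕ.* (v ℕ.* b) ≡ v ℕ.* (u ℕ.* a) ℕ.* b
    rearrange = ℕ-solve-∀

  weighted-sum : ∀ {d g a b c x p q w} → ¬ d ≈ 0# →
                 d * a ≈ p * g → d * b ≈ q * g → d * c ≈ w * g → d ≈ x * p + q + w →
                 g ≈ x * a + b + c
  weighted-sum {d} {g} {a} {b} {c} {x} {p} {q} {w} d≉0 da≈pg db≈qg dc≈wg d≈xp+q+w = *-cancelˡ d≉0 (begin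
    d * g                             ≈⟨ *-congʳ d≈xp+q+w ⟩
    (x * p + q + w) * g               ≈⟨ solve 5 (λ x p q w g → (x :* p :+ q :+ w) :* g := x :* (p :* g) :+ q :* g :+ w :* g)
                                           refl x p q w g ⟩
    x * (p * g) + q * g + w * g       ≈⟨ +-cong (+-cong (*-congˡ da≈pg) db≈qg) dc≈wg ⟨
    x * (d * a) + d * b + d * c       ≈⟨ solve 5 (λ x d a b c → x :* (d :* a) :+ d :* b :+ d :* c := d :* (x :* a :+ b :+ c))
                                           refl x d a b c ⟩
    d * (x * a + b + c)               ∎)

module FiniteSums {c ℓ} (F : CharZeroField c ℓ) where
  open CharZeroField F
  open FieldOps F
  open FieldFacts F
  open import Relation.Binary.Reasoning.Setoid setoid

  sumBelow-cong : ∀ n {f g : ℕ → Carrier} → (∀ k → k ℕ.< n → f k ≈ g k) → sumBelow n f ≈ sumBelow n g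
  sumBelow-cong zero    f≈g = refl
  sumBelow-cong (suc n) f≈g = +-cong (sumBelow-cong n (λ k k<n → f≈g k (ℕ.m<n⇒m<1+n k<n))) (f≈g n ℕ.≤-refl)

  sumBelow-zero : ∀ n {f : ℕ → Carrier} → (∀ k → k ℕ.< n → f k ≈ 0#) → sumBelow n f ≈ 0#
  sumBelow-zero zero    f≈0 = refl
  sumBelow-zero (suc n) f≈0 =
    trans (+-cong (sumBelow-zero n (λ k k<n → f≈0 k (ℕ.m<n⇒m<1+n k<n))) (f≈0 n ℕ.≤-refl)) (+-identityʳ 0#)

  sumBelow-+ : ∀ n (f g : ℕ → Carrier) → sumBelow n (λ k → f k + g k) ≈ sumBelow n f + sumBelow n g
  sumBelow-+ zero    f g = sym (+-identityʳ 0#)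
  sumBelow-+ (suc n) f g = trans (+-congʳ (sumBelow-+ n f g))
    (solve 4 (λ x y u v → (x :+ y) :+ (u :+ v) := (x :+ u) :+ (y :+ v)) refl _ _ _ _)

  sumBelow-*ˡ : ∀ n x (f : ℕ → Carrier) → x * sumBelow n f ≈ sumBelow n (λ k → x * f k)
  sumBelow-*ˡ zero    x f = zeroʳ x
  sumBelow-*ˡ (suc n) x f = trans (distribˡ x _ _) (+-congʳ (sumBelow-*ˡ n x f))

  sumBelow-sucˡ : ∀ n (f : ℕ → Carrier) → sumBelow (suc n) f ≈ f 0 + sumBelow n (λ k → f (suc k))
  sumBelow-sucˡ zero    f = +-comm 0# (f 0)
  sumBelow-sucˡ (suc n) f = trans (+-congʳ (sumBelow-sucˡ n f)) (+-assoc _ _ _)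

  sumBelow-extend : ∀ {m n} (f : ℕ → Carrier) → m ℕ.≤ n → (∀ k → m ℕ.≤ k → f k ≈ 0#) →
                    sumBelow n f ≈ sumBelow m f
  sumBelow-extend {m} {n} f m≤n f≈0 = begin
    sumBelow n f                           ≡⟨ ≡.cong (λ k → sumBelow k f) (ℕ.m∸n+n≡m m≤n) ⟨
    sumBelow (n ℕ.∸ m ℕ.+ m) f             ≈⟨ padding (n ℕ.∸ m) ⟩
    sumBelow m f                           ∎
    where
    padding : ∀ d → sumBelow (d ℕ.+ m) f ≈ sumBelow m f
    padding zero    = refl
    padding (suc d) = trans (+-cong (padding d) (f≈0 (d ℕ.+ m) (ℕ.m≤n+m m d))) (+-identityʳ _)

  sumBelow² : ℕ → (ℕ → ℕ → Carrier) → Carrier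
  sumBelow² m f = sumBelow m (λ j → sumBelow m (f j))

  sumBelow²-cong : ∀ m {f g : ℕ → ℕ → Carrier} → (∀ j i → f j i ≈ g j i) → sumBelow² m f ≈ sumBelow² m g
  sumBelow²-cong m f≈g = sumBelow-cong m (λ j _ → sumBelow-cong m (λ i _ → f≈g j i))

  sumBelow²-+ : ∀ m (f g : ℕ → ℕ → Carrier) →
                sumBelow² m (λ j i → f j i + g j i) ≈ sumBelow² m f + sumBelow² m g
  sumBelow²-+ m f g = trans (sumBelow-cong m (λ j _ → sumBelow-+ m (f j) (g j))) (sumBelow-+ m _ _)

  sumBelow²-*ˡ : ∀ m x (f : ℕ → ℕ → Carrier) → x * sumBelow² m f ≈ sumBelow² m (λ j i → x * f j i)
  sumBelow²-*ˡ m x f = trans (sumBelow-*ˡ m x _) (sumBelow-cong m (λ j _ → sumBelow-*ˡ m x (f j)))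

  sumBelow²-extend : ∀ {m n} (f : ℕ → ℕ → Carrier) → m ℕ.≤ n →
                     (∀ j i → m ℕ.≤ j ⊎ m ℕ.≤ i → f j i ≈ 0#) → sumBelow² n f ≈ sumBelow² m f
  sumBelow²-extend {m} {n} f m≤n f≈0 = trans
    (sumBelow-cong n (λ j _ → sumBelow-extend (f j) m≤n (λ i m≤i → f≈0 j i (inj₂ m≤i))))
    (sumBelow-extend (λ j → sumBelow m (f j)) m≤n
      (λ j m≤j → sumBelow-zero m (λ i _ → f≈0 j i (inj₁ m≤j))))

  shiftBoth : (ℕ → ℕ → Carrier) → ℕ → ℕ → Carrier
  shiftBoth f (suc j) (suc i) = f j i
  shiftBoth f _       _       = 0#

  shiftFirst : (ℕ → ℕ → Carrier) → ℕ → ℕ → Carrier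
  shiftFirst f zero    i = 0#
  shiftFirst f (suc j) i = f j i

  private
    dropFirstRow : ∀ m (f : ℕ → ℕ → Carrier) → (∀ i → f 0 i ≈ 0#) →
                   sumBelow (suc m) (λ j → sumBelow (suc m) (f j)) ≈ sumBelow m (λ j → sumBelow (suc m) (f (suc j)))
    dropFirstRow m f f0≈0 = begin
      sumBelow (suc m) (λ j → sumBelow (suc m) (f j))
        ≈⟨ sumBelow-sucˡ m _ ⟩
      sumBelow (suc m) (f 0) + sumBelow m (λ j → sumBelow (suc m) (f (suc j)))
        ≈⟨ +-congʳ (sumBelow-zero (suc m) (λ i _ → f0≈0 i)) ⟩
      0# + sumBelow m (λ j → sumBelow (suc m) (f (suc j)))
        ≈⟨ +-identityˡ _ ⟩
      sumBelow m (λ j → sumBelow (suc m) (f (suc j))) ∎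

  sumBelow²-shiftBoth : ∀ m (f : ℕ → ℕ → Carrier) → sumBelow² (suc m) (shiftBoth f) ≈ sumBelow² m f
  sumBelow²-shiftBoth m f = trans (dropFirstRow m (shiftBoth f) (λ _ → refl))
    (sumBelow-cong m (λ j _ → trans (sumBelow-sucˡ m (shiftBoth f (suc j))) (+-identityˡ _)))

  sumBelow²-shiftFirst : ∀ m (f : ℕ → ℕ → Carrier) → (∀ j → f j m ≈ 0#) →
                         sumBelow² (suc m) (shiftFirst f) ≈ sumBelow² m f
  sumBelow²-shiftFirst m f lastColumn≈0 = trans (dropFirstRow m (shiftFirst f) (λ _ → refl))
    (sumBelow-cong m (λ j _ → trans (+-congˡ (lastColumn≈0 j)) (+-identityʳ _)))

  below : (ℕ → Carrier) → ℕ → Carrier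
  below f zero    = 0#
  below f (suc k) = f k

  below-*ˡ : ∀ x (f : ℕ → Carrier) k → below (λ k → x * f k) k ≈ x * below f k
  below-*ˡ x f zero    = sym (zeroʳ x)
  below-*ˡ x f (suc k) = refl

  below-scale : ∀ (c f g h : ℕ → Carrier) → (∀ k → h (suc k) ≈ c k * g k) →
                ∀ k → below f k * h k ≈ below (λ k → c k * (f k * g k)) k
  below-scale c f g h h≈cg zero    = zeroˡ (h 0)
  below-scale c f g h h≈cg (suc k) = trans (*-congˡ (h≈cg k))
    (solve 3 (λ x y z → x :* (y :* z) := y :* (x :* z)) refl (f k) (c k) (g k))

module Powers {c ℓ} (F : CharZeroField c ℓ) where
  open CharZeroField F
  open FieldOps F
  open FieldFacts F
  open import Data.Integer using (+_)
  open import Relation.Binary.Reasoning.Setoid setoid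

  pow-cong : ∀ {x y} n → x ≈ y → pow x n ≈ pow y n
  pow-cong zero    x≈y = refl
  pow-cong (suc n) x≈y = *-cong (pow-cong n x≈y) x≈y

  pow-+ : ∀ x m n → pow x (m ℕ.+ n) ≈ pow x m * pow x n
  pow-+ x zero    n = sym (*-identityˡ _)
  pow-+ x (suc m) n = trans (*-congʳ (pow-+ x m n))
    (solve 3 (λ a b y → a :* b :* y := a :* y :* b) refl _ _ _)

  pow-* : ∀ x y n → pow (x * y) n ≈ pow x n * pow y n
  pow-* x y zero    = sym (*-identityˡ 1#)
  pow-* x y (suc n) = trans (*-congʳ (pow-* x y n))
    (solve 4 (λ a b u v → a :* b :* (u :* v) := a :* u :* (b :* v)) refl _ _ _ _)

  pow-1# : ∀ n → pow 1# n ≈ 1#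
  pow-1# zero    = refl
  pow-1# (suc n) = trans (*-identityʳ _) (pow-1# n)

  pow-inverse : ∀ {x} → ¬ x ≈ 0# → ∀ n → pow x n * pow (x ⁻¹) n ≈ 1#
  pow-inverse {x} x≉0 n = trans (sym (pow-* x (x ⁻¹) n)) (trans (pow-cong n (inverse x x≉0)) (pow-1# n))

  sgn-+ : ∀ m n → sgn (m ℕ.+ n) ≈ sgn m * sgn n
  sgn-+ = pow-+ (- 1#)

  sgn-square : ∀ n → sgn n * sgn n ≈ 1#
  sgn-square n = begin
    sgn n * sgn n          ≈⟨ pow-* (- 1#) (- 1#) n ⟨
    pow (- 1# * - 1#) n    ≈⟨ pow-cong n (solve 0 (:- con (+ 1) :* :- con (+ 1) := con (+ 1)) refl) ⟩
    pow 1# n               ≈⟨ pow-1# n ⟩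
    1#                     ∎

  poch-cong : ∀ {a b} n → a ≈ b → poch a n ≈ poch b n
  poch-cong zero    a≈b = refl
  poch-cong (suc n) a≈b = *-cong (poch-cong n a≈b) (+-congʳ a≈b)

  poch-sucˡ : ∀ a n → poch a (suc n) ≈ a * poch (a + 1#) n
  poch-sucˡ a zero    = solve 1 (λ a → con (+ 1) :* (a :+ con (+ 0)) := a :* con (+ 1)) refl a
  poch-sucˡ a (suc n) = begin
    poch a (suc n) * (a + ι (suc n))         ≈⟨ *-congʳ (poch-sucˡ a n) ⟩
    a * poch (a + 1#) n * (a + (1# + ι n))   ≈⟨ solve 3 (λ a p m → a :* p :* (a :+ (con (+ 1) :+ m))
                                                    := a :* (p :* ((a :+ con (+ 1)) :+ m))) refl a (poch (a + 1#) n) (ι n) ⟩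
    a * poch (a + 1#) (suc n)                ∎

  poch-nonzero : ∀ {a} n → (∀ m → m ℕ.< n → ¬ a + ι m ≈ 0#) → ¬ poch a n ≈ 0#
  poch-nonzero zero    _       = 1≉0
  poch-nonzero (suc n) factors = *-nonzero (poch-nonzero n (λ m m<n → factors m (ℕ.m<n⇒m<1+n m<n))) (factors n ℕ.≤-refl)

  Λ-suc : ∀ B i → Λ B (suc i) ≈ (B - ι (suc i)) * (B + ι i) * Λ B i
  Λ-suc B i = begin
    poch (B - ι (suc i)) (suc i) * (poch B i * (B + ι i))
      ≈⟨ *-congʳ (poch-sucˡ (B - ι (suc i)) i) ⟩
    (B - ι (suc i)) * poch (B - ι (suc i) + 1#) i * (poch B i * (B + ι i))
      ≈⟨ *-congʳ (*-congˡ (poch-cong i (solve 2 (λ b m → b :- (con (+ 1) :+ m) :+ con (+ 1) := b :- m) refl B (ι i)))) ⟩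
    (B - ι (suc i)) * poch (B - ι i) i * (poch B i * (B + ι i))
      ≈⟨ solve 5 (λ x p q b m → x :* p :* (q :* (b :+ m)) := x :* (b :+ m) :* (p :* q)) refl
           (B - ι (suc i)) (poch (B - ι i) i) (poch B i) B (ι i) ⟩
    (B - ι (suc i)) * (B + ι i) * Λ B i ∎

module ThreeTermRecurrences {c ℓ} (F : CharZeroField c ℓ) where
  open CharZeroField F
  open FieldOps F
  open FieldFacts F
  open import Data.Product using (_×_; _,_; proj₁)
  open import Relation.Binary.Reasoning.Setoid setoid

  ThreeTerm : (a b x : ℕ → Carrier) → Set ℓ
  ThreeTerm a b x = ∀ n → x (suc (suc n)) ≈ a n * x (suc n) + b n * x n

  threeTerm-cong : ∀ {a b x y} → (∀ n → x n ≈ y n) → ThreeTerm a b y → ThreeTerm a b x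
  threeTerm-cong {a} {b} x≈y y-rec n =
    trans (x≈y (suc (suc n))) (trans (y-rec n) (sym (+-cong (*-congˡ (x≈y (suc n))) (*-congˡ (x≈y n)))))

  threeTerm-*ˡ : ∀ {a b x} c → ThreeTerm a b x → ThreeTerm a b (λ n → c * x n)
  threeTerm-*ˡ {a} {b} {x} c x-rec n = trans (*-congˡ (x-rec n))
    (solve 5 (λ c a x₁ b x₀ → c :* (a :* x₁ :+ b :* x₀) := a :* (c :* x₁) :+ b :* (c :* x₀)) refl
      c (a n) (x (suc n)) (b n) (x n))

  threeTerm-span : ∀ {a b x y w} α β → ThreeTerm a b x → ThreeTerm a b y → ThreeTerm a b w →
                   w 0 ≈ x 0 * α + y 0 * β → w 1 ≈ x 1 * α + y 1 * β → ∀ n → w n ≈ x n * α + y n * β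
  threeTerm-span {a} {b} {x} {y} {w} α β x-rec y-rec w-rec w₀ w₁ n = proj₁ (consecutive n)
    where
    consecutive : ∀ n → w n ≈ x n * α + y n * β × w (suc n) ≈ x (suc n) * α + y (suc n) * β
    consecutive zero    = w₀ , w₁
    consecutive (suc n) with consecutive n
    ... | wₙ , wₙ₊₁ = wₙ₊₁ , (begin
      w (suc (suc n))
        ≈⟨ w-rec n ⟩
      a n * w (suc n) + b n * w n
        ≈⟨ +-cong (*-congˡ wₙ₊₁) (*-congˡ wₙ) ⟩
      a n * (x (suc n) * α + y (suc n) * β) + b n * (x n * α + y n * β)
        ≈⟨ solve 8 (λ a b x₁ y₁ x₀ y₀ α β → a :* (x₁ :* α :+ y₁ :* β) :+ b :* (x₀ :* α :+ y₀ :* β)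
                                            := (a :* x₁ :+ b :* x₀) :* α :+ (a :* y₁ :+ b :* y₀) :* β)
             refl (a n) (b n) (x (suc n)) (y (suc n)) (x n) (y n) α β ⟩
      (a n * x (suc n) + b n * x n) * α + (a n * y (suc n) + b n * y n) * β
        ≈⟨ +-cong (*-congʳ (x-rec n)) (*-congʳ (y-rec n)) ⟨
      x (suc (suc n)) * α + y (suc (suc n)) * β ∎)


infixl 6 _∸?_

_∸?_ : ℕ → ℕ → Maybe ℕ
m     ∸? zero  = just m
zero  ∸? suc k = nothing
suc m ∸? suc k = m ∸? k

pred? : Maybe ℕ → Maybe ℕ
pred? (just (suc r)) = just r
pred? _              = nothing

∸?-suc : ∀ m k → m ∸? suc k ≡ pred? (m ∸? k)
∸?-suc zero    zero    = ≡.refl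
∸?-suc (suc m) zero    = ≡.refl
∸?-suc zero    (suc k) = ≡.refl
∸?-suc (suc m) (suc k) = ∸?-suc m k

∸?-just : ∀ m k {r} → m ∸? k ≡ just r → m ≡ k ℕ.+ r
∸?-just m       zero    ≡.refl = ≡.refl
∸?-just (suc m) (suc k) eq     = ≡.cong suc (∸?-just m k eq)

∸?-≤ : ∀ {m k} → k ℕ.≤ m → m ∸? k ≡ just (m ℕ.∸ k)
∸?-≤ {m} {zero}  _          = ≡.refl
∸?-≤ {suc m} {suc k} (ℕ.s≤s k≤m) = ∸?-≤ k≤m

∸?-< : ∀ {m k} → m ℕ.< k → m ∸? k ≡ nothing
∸?-< {zero}  {suc k} _          = ≡.refl
∸?-< {suc m} {suc k} (ℕ.s≤s m<k) = ∸?-< m<k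

m≤n/o⇒m*o≤n : ∀ {m n o} .{{_ : ℕ.NonZero o}} → m ℕ.≤ n ℕ./ o → m ℕ.* o ℕ.≤ n
m≤n/o⇒m*o≤n {m} {n} {o} m≤n/o = ℕ.≤-trans (ℕ.*-monoˡ-≤ o m≤n/o) (ℕ.m/n*n≤m n o)

m*o≤n⇒m≤n/o : ∀ {m n o} .{{_ : ℕ.NonZero o}} → m ℕ.* o ℕ.≤ n → m ℕ.≤ n ℕ./ o
m*o≤n⇒m≤n/o {m} {n} {o} m*o≤n = ≡.subst (ℕ._≤ n ℕ./ o) (ℕ.m*n/n≡m m o) (ℕ./-monoˡ-≤ o m*o≤n)

j<1+n/2⇔ : ∀ n j → (j ℕ.< suc (n ℕ./ 2)) ⇔ (2 ℕ.* j ℕ.+ 0 ℕ.≤ n)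
j<1+n/2⇔ n j = mk⇔
  (λ j<1+n/2 → ≡.subst (ℕ._≤ n) (twice j) (m≤n/o⇒m*o≤n (ℕ.≤-pred j<1+n/2)))
  (λ 2j≤n → ℕ.s≤s (m*o≤n⇒m≤n/o (≡.subst (ℕ._≤ n) (≡.sym (twice j)) 2j≤n)))
  where
  twice : ∀ j → j ℕ.* 2 ≡ 2 ℕ.* j ℕ.+ 0
  twice = ℕ-solve-∀

j<[1+n]/2⇔ : ∀ n j → (j ℕ.< suc n ℕ./ 2) ⇔ (2 ℕ.* j ℕ.+ 1 ℕ.≤ n)
j<[1+n]/2⇔ n j = mk⇔
  (λ j<[1+n]/2 → ≡.subst (ℕ._≤ n) (twice+1 j) (ℕ.≤-pred (m≤n/o⇒m*o≤n j<[1+n]/2)))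
  (λ 2j+1≤n → m*o≤n⇒m≤n/o (ℕ.s≤s (≡.subst (ℕ._≤ n) (≡.sym (twice+1 j)) 2j+1≤n)))
  where
  twice+1 : ∀ j → suc (j ℕ.* 2) ≡ 2 ℕ.* j ℕ.+ 1
  twice+1 = ℕ-solve-∀

module Contiguity {c ℓ} (F : CharZeroField c ℓ) where
  open CharZeroField F
  open FieldFacts F using (ι-homo-+; solve; _:=_; con; _:+_; _:*_; _:-_)
  open FiniteSums F using (below)
  open import Data.Integer using (+_)
  open import Relation.Binary.Reasoning.Setoid setoid

  gap : ℕ → ℕ → Carrier
  gap n i = ι (suc (suc n)) * ι (suc n) - ι i * ι (suc i)

  gap-factor : ∀ n i q → suc n ≡ i ℕ.+ q → gap n i ≈ ι (suc (suc n) ℕ.+ i) * ι q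
  gap-factor n i q n+1≡i+q = begin
    ι (suc (suc n)) * ι (suc n) - ι i * ι (suc i)
      ≈⟨ +-congʳ (*-cong (+-congˡ n+1≈i+q) n+1≈i+q) ⟩
    (1# + (ι i + ι q)) * (ι i + ι q) - ι i * (1# + ι i)
      ≈⟨ solve 2 (λ a b → (con (+ 1) :+ (a :+ b)) :* (a :+ b) :- a :* (con (+ 1) :+ a)
                          := (con (+ 1) :+ (a :+ b) :+ a) :* b) refl (ι i) (ι q) ⟩
    (1# + (ι i + ι q) + ι i) * ι q
      ≈⟨ *-congʳ (trans (ι-homo-+ (suc (suc n)) i) (+-congʳ (+-congˡ n+1≈i+q))) ⟨
    ι (suc (suc n) ℕ.+ i) * ι q ∎
    where
    n+1≈i+q : ι (suc n) ≈ ι i + ι q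
    n+1≈i+q = trans (reflexive (≡.cong ι n+1≡i+q)) (ι-homo-+ i q)

  Contiguous : ℕ → (ℕ → ℕ → ℕ → Carrier) → Set ℓ
  Contiguous e γ = ∀ n i s r → 2 ℕ.* (i ℕ.+ s) ℕ.+ e ℕ.+ r ≡ suc (suc n) →
    γ i s r ≈ ι (suc (suc n)) * below (γ i s) r + below (λ i → γ i s r) i + gap n i * below (λ s → γ i s r) s

module TriangularSums {c ℓ} (F : CharZeroField c ℓ) (B Z K : CharZeroField.Carrier F)
                      (e : ℕ) (γ : ℕ → ℕ → ℕ → CharZeroField.Carrier F) where
  open CharZeroField F
  open FieldOps F
  open FieldFacts F
  open FiniteSums F
  open Powers F
  open ThreeTermRecurrences F
  open Contiguity F
  open import Data.Integer using (+_)
  open import Relation.Binary.Reasoning.Setoid setoid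

  monomial : ℕ → ℕ → ℕ → Carrier
  monomial i s r = sgn s * pow Z r * pow K (i ℕ.+ s ℕ.+ e) * Λ B i

  term : ℕ → Maybe ℕ → Maybe ℕ → Carrier
  term i (just s) (just r) = γ i s r * monomial i s r
  term i _        _        = 0#

  -- entry n j i is the (j, i) summand of the n-th sum, through s = j - i and r = n - 2j - e;
  -- nothing stands for a negative s or r, where the summand is zero.
  entry : ℕ → ℕ → ℕ → Carrier
  entry n j i = term i (j ∸? i) (n ∸? (2 ℕ.* j ℕ.+ e))

  total : ℕ → Carrier
  total n = sumBelow² (suc n) (entry n)

  term-nothingʳ : ∀ i y → term i y nothing ≈ 0#
  term-nothingʳ i nothing  = refl
  term-nothingʳ i (just s) = refl

  entry-vanishesʳ : ∀ n j i → n ℕ.< 2 ℕ.* j ℕ.+ e → entry n j i ≈ 0#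
  entry-vanishesʳ n j i n<2j+e = trans (reflexive (≡.cong (term i (j ∸? i)) (∸?-< n<2j+e))) (term-nothingʳ i (j ∸? i))

  entry-vanishesˢ : ∀ n j i → j ℕ.< i → entry n j i ≈ 0#
  entry-vanishesˢ n j i j<i = reflexive (≡.cong (λ y → term i y (n ∸? (2 ℕ.* j ℕ.+ e))) (∸?-< j<i))

  entry-vanishes : ∀ n j i → n ℕ.< j ⊎ n ℕ.< i → entry n j i ≈ 0#
  entry-vanishes n j i (inj₁ n<j) =
    entry-vanishesʳ n j i (ℕ.<-≤-trans n<j (ℕ.≤-trans (ℕ.m≤n*m j 2) (ℕ.m≤m+n (2 ℕ.* j) e)))
  entry-vanishes n j i (inj₂ n<i) with i ℕ.≤? j
  ... | yes i≤j = entry-vanishes n j i (inj₁ (ℕ.<-≤-trans n<i i≤j))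
  ... | no  i≰j = entry-vanishesˢ n j i (ℕ.≰⇒> i≰j)

  total-extend : ∀ n m → suc n ℕ.≤ m → sumBelow² m (entry n) ≈ total n
  total-extend n m n<m = sumBelow²-extend (entry n) n<m (entry-vanishes n)

  monomial-sucʳ : ∀ i s r → monomial i s (suc r) ≈ Z * monomial i s r
  monomial-sucʳ i s r = solve 5 (λ σ z x k l → σ :* (x :* z) :* k :* l := z :* (σ :* x :* k :* l)) refl
    (sgn s) Z (pow Z r) (pow K (i ℕ.+ s ℕ.+ e)) (Λ B i)

  stepⁱ : ℕ → Carrier
  stepⁱ i = K * (B - ι (suc i)) * (B + ι i)

  monomial-sucⁱ : ∀ i s r → monomial (suc i) s r ≈ stepⁱ i * monomial i s r
  monomial-sucⁱ i s r = begin
    sgn s * pow Z r * (pow K (i ℕ.+ s ℕ.+ e) * K) * Λ B (suc i)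
      ≈⟨ *-congˡ (Λ-suc B i) ⟩
    sgn s * pow Z r * (pow K (i ℕ.+ s ℕ.+ e) * K) * ((B - ι (suc i)) * (B + ι i) * Λ B i)
      ≈⟨ solve 7 (λ σ x k κ u v l → σ :* x :* (k :* κ) :* (u :* v :* l) := κ :* u :* v :* (σ :* x :* k :* l)) refl
           (sgn s) (pow Z r) (pow K (i ℕ.+ s ℕ.+ e)) K (B - ι (suc i)) (B + ι i) (Λ B i) ⟩
    stepⁱ i * monomial i s r ∎

  monomial-sucˢ : ∀ i s r → monomial i (suc s) r ≈ - K * monomial i s r
  monomial-sucˢ i s r = begin
    sgn s * - 1# * pow Z r * pow K (i ℕ.+ suc s ℕ.+ e) * Λ B i
      ≡⟨ ≡.cong (λ m → sgn s * - 1# * pow Z r * pow K (m ℕ.+ e) * Λ B i) (ℕ.+-suc i s) ⟩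
    sgn s * - 1# * pow Z r * (pow K (i ℕ.+ s ℕ.+ e) * K) * Λ B i
      ≈⟨ solve 5 (λ σ x k κ l → σ :* :- con (+ 1) :* x :* (k :* κ) :* l := :- κ :* (σ :* x :* k :* l)) refl
           (sgn s) (pow Z r) (pow K (i ℕ.+ s ℕ.+ e)) K (Λ B i) ⟩
    - K * monomial i s r ∎

  liftⁱ : ℕ → Maybe ℕ → Maybe ℕ → Carrier
  liftⁱ zero    y x = 0#
  liftⁱ (suc i) y x = stepⁱ i * term i y x

  module _ (γ-contiguous : Contiguous e γ) (n : ℕ) where
    private
      N : Carrier
      N = ι (suc (suc n))

      t : ℕ → ℕ → ℕ → Carrier
      t i s r = γ i s r * monomial i s r

      t-split : ∀ i s r → 2 ℕ.* (i ℕ.+ s) ℕ.+ e ℕ.+ r ≡ suc (suc n) →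
        t i s r ≈ Z * N * below (t i s) r + below (λ i → stepⁱ i * t i s r) i + - K * gap n i * below (λ s → t i s r) s
      t-split i s r level = begin
        γ i s r * monomial i s r
          ≈⟨ *-congʳ (γ-contiguous n i s r level) ⟩
        (N * below (γ i s) r + below (λ i → γ i s r) i + gap n i * below (λ s → γ i s r) s) * monomial i s r
          ≈⟨ solve 6 (λ x a b g d m → (x :* a :+ b :+ g :* d) :* m := x :* (a :* m) :+ b :* m :+ g :* (d :* m)) refl
               N (below (γ i s) r) (below (λ i → γ i s r) i) (gap n i) (below (λ s → γ i s r) s) (monomial i s r) ⟩
        N * (below (γ i s) r * monomial i s r) + below (λ i → γ i s r) i * monomial i s r
          + gap n i * (below (λ s → γ i s r) s * monomial i s r)
          ≈⟨ +-cong (+-cong (*-congˡ fromR) fromI) (*-congˡ fromS) ⟩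
        N * (Z * below (t i s) r) + below (λ i → stepⁱ i * t i s r) i + gap n i * (- K * below (λ s → t i s r) s)
          ≈⟨ solve 7 (λ x z a b g k d → x :* (z :* a) :+ b :+ g :* (:- k :* d) := z :* x :* a :+ b :+ :- k :* g :* d) refl
               N Z (below (t i s) r) (below (λ i → stepⁱ i * t i s r) i) (gap n i) K (below (λ s → t i s r) s) ⟩
        Z * N * below (t i s) r + below (λ i → stepⁱ i * t i s r) i + - K * gap n i * below (λ s → t i s r) s ∎
        where
        fromR : below (γ i s) r * monomial i s r ≈ Z * below (t i s) r
        fromR = trans (below-scale (λ _ → Z) (γ i s) (monomial i s) (monomial i s) (monomial-sucʳ i s) r)
                      (below-*ˡ Z (t i s) r)
        fromI : below (λ i → γ i s r) i * monomial i s r ≈ below (λ i → stepⁱ i * t i s r) i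
        fromI = below-scale stepⁱ (λ i → γ i s r) (λ i → monomial i s r) (λ i → monomial i s r)
                  (λ i → monomial-sucⁱ i s r) i
        fromS : below (λ s → γ i s r) s * monomial i s r ≈ - K * below (λ s → t i s r) s
        fromS = trans (below-scale (λ _ → - K) (λ s → γ i s r) (λ s → monomial i s r) (λ s → monomial i s r)
                        (λ s → monomial-sucˢ i s r) s)
                      (below-*ˡ (- K) (λ s → t i s r) s)

      below-pred? : ∀ (g : Maybe ℕ → Carrier) → g nothing ≡ 0# →
                    ∀ k → g (pred? (just k)) ≡ below (λ k → g (just k)) k
      below-pred? g g-nothing zero    = g-nothing
      below-pred? g g-nothing (suc k) = ≡.refl

      liftⁱ-vanishes : ∀ i {y x} → (∀ i → term i y x ≈ 0#) → liftⁱ i y x ≈ 0#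
      liftⁱ-vanishes zero    _       = refl
      liftⁱ-vanishes (suc i) term≈0 = trans (*-congˡ (term≈0 i)) (zeroʳ _)

      vanishing-split : ∀ {i a b c} → a ≈ 0# → b ≈ 0# → c ≈ 0# → 0# ≈ Z * N * a + b + - K * gap n i * c
      vanishing-split a≈0 b≈0 c≈0 = sym (trans (+-cong (+-cong (trans (*-congˡ a≈0) (zeroʳ _)) b≈0)
                                                        (trans (*-congˡ c≈0) (zeroʳ _)))
                                               (trans (+-identityʳ _) (+-identityʳ _)))

      liftⁱ-below : ∀ i s r → liftⁱ i (just s) (just r) ≡ below (λ i → stepⁱ i * t i s r) i
      liftⁱ-below zero    s r = ≡.refl
      liftⁱ-below (suc i) s r = ≡.refl

    term-split : ∀ i y x → (∀ {s r} → y ≡ just s → x ≡ just r → 2 ℕ.* (i ℕ.+ s) ℕ.+ e ℕ.+ r ≡ suc (suc n)) →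
      term i y x ≈ Z * N * term i y (pred? x) + liftⁱ i y x + - K * gap n i * term i (pred? y) x
    term-split i nothing  x       _ = vanishing-split {i} refl (liftⁱ-vanishes i (λ _ → refl)) refl
    term-split i (just s) nothing _ =
      vanishing-split {i} refl (liftⁱ-vanishes i (λ _ → refl)) (term-nothingʳ i (pred? (just s)))
    term-split i (just s) (just r) level = begin
      t i s r
        ≈⟨ t-split i s r (level ≡.refl ≡.refl) ⟩
      Z * N * below (t i s) r + below (λ i → stepⁱ i * t i s r) i + - K * gap n i * below (λ s → t i s r) s
        ≡⟨ ≡.cong₂ _+_ (≡.cong₂ _+_ (≡.cong (Z * N *_) (≡.sym (below-pred? (term i (just s)) ≡.refl r)))
                                    (≡.sym (liftⁱ-below i s r)))
                       (≡.cong (- K * gap n i *_) (≡.sym (below-pred? (λ y → term i y (just r)) ≡.refl s))) ⟩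
      Z * N * term i (just s) (pred? (just r)) + liftⁱ i (just s) (just r) + - K * gap n i * term i (pred? (just s)) (just r) ∎

    private
      contributionⁱ contributionˢ : ℕ → ℕ → Carrier
      contributionⁱ j i = stepⁱ i * entry n j i
      contributionˢ j i = - K * gap n i * entry n j i

      level-suc : ∀ j → suc (suc n) ∸? (2 ℕ.* suc j ℕ.+ e) ≡ n ∸? (2 ℕ.* j ℕ.+ e)
      level-suc j = ≡.cong (λ m → suc (suc n) ∸? (m ℕ.+ e)) (ℕ.*-suc 2 j)

      liftⁱ≈contributionⁱ : ∀ j i →
                            liftⁱ i (j ∸? i) (suc (suc n) ∸? (2 ℕ.* j ℕ.+ e)) ≈ shiftBoth contributionⁱ j i
      liftⁱ≈contributionⁱ zero    zero    = refl
      liftⁱ≈contributionⁱ (suc j) zero    = refl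
      liftⁱ≈contributionⁱ zero    (suc i) = zeroʳ _
      liftⁱ≈contributionⁱ (suc j) (suc i) = *-congˡ (reflexive (≡.cong (term i (j ∸? i)) (level-suc j)))

      liftˢ≈contributionˢ : ∀ j i → - K * gap n i * term i (pred? (j ∸? i)) (suc (suc n) ∸? (2 ℕ.* j ℕ.+ e))
                            ≈ shiftFirst contributionˢ j i
      liftˢ≈contributionˢ zero    i =
        trans (*-congˡ (reflexive (≡.cong (λ y → term i y _) (≡.sym (∸?-suc 0 i))))) (zeroʳ _)
      liftˢ≈contributionˢ (suc j) i = *-congˡ (reflexive (≡.cong₂ (term i) (≡.sym (∸?-suc (suc j) i)) (level-suc j)))

    entry-split : ∀ j i → entry (suc (suc n)) j i
                          ≈ Z * N * entry (suc n) j i + shiftBoth contributionⁱ j i + shiftFirst contributionˢ j i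
    entry-split j i = begin
      term i y x
        ≈⟨ term-split i y x level ⟩
      Z * N * term i y (pred? x) + liftⁱ i y x + - K * gap n i * term i (pred? y) x
        ≈⟨ +-cong (+-cong (*-congˡ (reflexive (≡.cong (term i y) (≡.sym (∸?-suc (suc (suc n)) (2 ℕ.* j ℕ.+ e))))))
                          (liftⁱ≈contributionⁱ j i))
                  (liftˢ≈contributionˢ j i) ⟩
      Z * N * entry (suc n) j i + shiftBoth contributionⁱ j i + shiftFirst contributionˢ j i ∎
      where
      y = j ∸? i
      x = suc (suc n) ∸? (2 ℕ.* j ℕ.+ e)
      level : ∀ {s r} → y ≡ just s → x ≡ just r → 2 ℕ.* (i ℕ.+ s) ℕ.+ e ℕ.+ r ≡ suc (suc n)
      level {s} {r} y≡s x≡r = ≡.trans (≡.cong (λ j → 2 ℕ.* j ℕ.+ e ℕ.+ r) (≡.sym (∸?-just j i y≡s)))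
                                      (≡.sym (∸?-just (suc (suc n)) (2 ℕ.* j ℕ.+ e) x≡r))

    total-recurrence : total (suc (suc n)) ≈ Z * N * total (suc n) + K * (B - N) * (B + ι (suc n)) * total n
    total-recurrence = begin
      sumBelow² (3 ℕ.+ n) (entry (suc (suc n)))
        ≈⟨ sumBelow²-cong (3 ℕ.+ n) entry-split ⟩
      sumBelow² (3 ℕ.+ n) (λ j i → Z * N * entry (suc n) j i + shiftBoth contributionⁱ j i + shiftFirst contributionˢ j i)
        ≈⟨ trans (sumBelow²-+ (3 ℕ.+ n) _ _) (+-congʳ (sumBelow²-+ (3 ℕ.+ n) _ _)) ⟩
      sumBelow² (3 ℕ.+ n) (λ j i → Z * N * entry (suc n) j i) + sumBelow² (3 ℕ.+ n) (shiftBoth contributionⁱ)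
        + sumBelow² (3 ℕ.+ n) (shiftFirst contributionˢ)
        ≈⟨ +-cong (+-cong (trans (sym (sumBelow²-*ˡ (3 ℕ.+ n) (Z * N) (entry (suc n))))
                                 (*-congˡ (total-extend (suc n) (3 ℕ.+ n) (ℕ.n≤1+n _))))
                          (sumBelow²-shiftBoth (2 ℕ.+ n) contributionⁱ))
                  (sumBelow²-shiftFirst (2 ℕ.+ n) contributionˢ
                    (λ j → trans (*-congˡ (entry-vanishes n j (2 ℕ.+ n) (inj₂ (ℕ.m<n⇒m<1+n (ℕ.n<1+n n))))) (zeroʳ _))) ⟩
      Z * N * total (suc n) + sumBelow² (2 ℕ.+ n) contributionⁱ + sumBelow² (2 ℕ.+ n) contributionˢ
        ≈⟨ trans (+-assoc _ _ _) (+-congˡ (sym (sumBelow²-+ (2 ℕ.+ n) contributionⁱ contributionˢ))) ⟩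
      Z * N * total (suc n) + sumBelow² (2 ℕ.+ n) (λ j i → contributionⁱ j i + contributionˢ j i)
        ≈⟨ +-congˡ (sumBelow²-cong (2 ℕ.+ n) (λ j i → coefficients (entry n j i) i)) ⟩
      Z * N * total (suc n) + sumBelow² (2 ℕ.+ n) (λ j i → K * (B - N) * (B + ι (suc n)) * entry n j i)
        ≈⟨ +-congˡ (trans (sym (sumBelow²-*ˡ (2 ℕ.+ n) _ (entry n))) (*-congˡ (total-extend n (2 ℕ.+ n) (ℕ.n≤1+n _)))) ⟩
      Z * N * total (suc n) + K * (B - N) * (B + ι (suc n)) * total n ∎
      where
      coefficients : ∀ x i → stepⁱ i * x + - K * gap n i * x ≈ K * (B - N) * (B + ι (suc n)) * x
      coefficients x i = solve 5 (λ k b m l x →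
          k :* (b :- (con (+ 1) :+ m)) :* (b :+ m) :* x
            :+ :- k :* ((con (+ 1) :+ (con (+ 1) :+ l)) :* (con (+ 1) :+ l) :- m :* (con (+ 1) :+ m)) :* x
          := k :* (b :- (con (+ 1) :+ (con (+ 1) :+ l))) :* (b :+ (con (+ 1) :+ l)) :* x)
        refl K B (ι i) (ι n) x

  total-threeTerm : Contiguous e γ →
                ThreeTerm (λ n → Z * ι (suc (suc n))) (λ n → K * (B - ι (suc (suc n))) * (B + ι (suc n))) total
  total-threeTerm γ-contiguous n = total-recurrence γ-contiguous n

module Coefficients {c ℓ} (F : CharZeroField c ℓ) (e : ℕ) where
  open CharZeroField F
  open FieldOps F
  open FieldFacts F
  open FiniteSums F using (below)
  open Contiguity F
  open import Data.Nat using (_!)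
  open import Relation.Binary.Reasoning.Setoid setoid

  numerator denominator weight : ℕ → ℕ → ℕ → ℕ
  numerator   i s r = (i ℕ.+ s ℕ.+ r) ! ℕ.* (e ℕ.+ (i ℕ.+ s ℕ.+ s ℕ.+ r)) !
  denominator i s r = r ! ℕ.* (i ! ℕ.* (e ℕ.+ i) ! ℕ.* s !)
  weight      i s r = (i ℕ.+ s ℕ.+ r) ℕ.* (e ℕ.+ (i ℕ.+ s ℕ.+ s ℕ.+ r))

  γ : ℕ → ℕ → ℕ → Carrier
  γ i s r = frac (numerator i s r) (denominator i s r)

  denominator-nonZero : ∀ i s r → ℕ.NonZero (denominator i s r)
  denominator-nonZero i s r = ℕ.m*n≢0 (r !) _ {{r ℕ.!≢0}}
    {{ℕ.m*n≢0 (i ! ℕ.* (e ℕ.+ i) !) (s !) {{i ℕ.!* (e ℕ.+ i) !≢0}} {{s ℕ.!≢0}}}}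

  γ-as-product : ∀ i s r →
    γ i s r ≈ frac ((i ℕ.+ s ℕ.+ r) !) (r !) * frac ((e ℕ.+ (i ℕ.+ s ℕ.+ s ℕ.+ r)) !) (i ! ℕ.* (e ℕ.+ i) ! ℕ.* s !)
  γ-as-product i s r = sym (frac-* ((i ℕ.+ s ℕ.+ r) !) (r !) ((e ℕ.+ (i ℕ.+ s ℕ.+ s ℕ.+ r)) !)
    (i ! ℕ.* (e ℕ.+ i) ! ℕ.* s !) {{r ℕ.!≢0}} {{ℕ.m*n≢0 (i ! ℕ.* (e ℕ.+ i) !) (s !) {{i ℕ.!* (e ℕ.+ i) !≢0}} {{s ℕ.!≢0}}}})

  private
    !-pair : ∀ a b {a′ b′} → a′ ≡ suc a → b′ ≡ suc b → a′ ! ℕ.* b′ ! ≡ a′ ℕ.* b′ ℕ.* (a ! ℕ.* b !)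
    !-pair a b ≡.refl ≡.refl = rearrange (suc a) (suc b) (a !) (b !)
      where
      rearrange : ∀ a b x y → a ℕ.* x ℕ.* (b ℕ.* y) ≡ a ℕ.* b ℕ.* (x ℕ.* y)
      rearrange = ℕ-solve-∀

    !-pair₂ : ∀ a b {a′ b′} → a′ ≡ suc a → b′ ≡ suc (suc b) →
              a′ ! ℕ.* b′ ! ≡ a′ ℕ.* b′ ℕ.* suc b ℕ.* (a ! ℕ.* b !)
    !-pair₂ a b ≡.refl ≡.refl = rearrange (suc a) (suc (suc b)) (suc b) (a !) (b !)
      where
      rearrange : ∀ a b b′ x y → a ℕ.* x ℕ.* (b ℕ.* (b′ ℕ.* y)) ≡ a ℕ.* b ℕ.* b′ ℕ.* (x ℕ.* y)
      rearrange = ℕ-solve-∀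

    e+suc : ∀ m → e ℕ.+ suc m ≡ suc (e ℕ.+ m)
    e+suc = ℕ.+-suc e

  numerator-sucʳ : ∀ i s r → numerator i s (suc r) ≡ weight i s (suc r) ℕ.* numerator i s r
  numerator-sucʳ i s r = !-pair (i ℕ.+ s ℕ.+ r) (e ℕ.+ (i ℕ.+ s ℕ.+ s ℕ.+ r)) (ℕ.+-suc (i ℕ.+ s) r)
    (≡.trans (≡.cong (e ℕ.+_) (ℕ.+-suc (i ℕ.+ s ℕ.+ s) r)) (e+suc _))

  numerator-sucⁱ : ∀ i s r → numerator (suc i) s r ≡ weight (suc i) s r ℕ.* numerator i s r
  numerator-sucⁱ i s r = !-pair (i ℕ.+ s ℕ.+ r) (e ℕ.+ (i ℕ.+ s ℕ.+ s ℕ.+ r)) ≡.refl (e+suc _)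

  numerator-sucˢ : ∀ i s r → numerator i (suc s) r
                           ≡ weight i (suc s) r ℕ.* suc (e ℕ.+ (i ℕ.+ s ℕ.+ s ℕ.+ r)) ℕ.* numerator i s r
  numerator-sucˢ i s r = !-pair₂ (i ℕ.+ s ℕ.+ r) (e ℕ.+ (i ℕ.+ s ℕ.+ s ℕ.+ r)) (≡.cong (ℕ._+ r) (ℕ.+-suc i s))
    (≡.trans (≡.cong (λ m → e ℕ.+ (m ℕ.+ r))
                     (≡.trans (≡.cong (ℕ._+ suc s) (ℕ.+-suc i s)) (≡.cong suc (ℕ.+-suc (i ℕ.+ s) s))))
             (≡.trans (e+suc _) (≡.cong suc (e+suc _))))

  denominator-sucʳ : ∀ i s r → denominator i s (suc r) ≡ suc r ℕ.* denominator i s r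
  denominator-sucʳ i s r = ℕ.*-assoc (suc r) (r !) _

  denominator-sucⁱ : ∀ i s r → denominator (suc i) s r ≡ suc i ℕ.* suc (e ℕ.+ i) ℕ.* denominator i s r
  denominator-sucⁱ i s r rewrite e+suc i = rearrange (r !) (suc i) (i !) (suc (e ℕ.+ i)) ((e ℕ.+ i) !) (s !)
    where
    rearrange : ∀ ρ a x b y σ → ρ ℕ.* (a ℕ.* x ℕ.* (b ℕ.* y) ℕ.* σ) ≡ a ℕ.* b ℕ.* (ρ ℕ.* (x ℕ.* y ℕ.* σ))
    rearrange = ℕ-solve-∀

  denominator-sucˢ : ∀ i s r → denominator i (suc s) r ≡ suc s ℕ.* denominator i s r
  denominator-sucˢ i s r = rearrange (r !) (i ! ℕ.* (e ℕ.+ i) !) (suc s) (s !)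
    where
    rearrange : ∀ ρ x a σ → ρ ℕ.* (x ℕ.* (a ℕ.* σ)) ≡ a ℕ.* (ρ ℕ.* (x ℕ.* σ))
    rearrange = ℕ-solve-∀

  γ-ratio : ∀ i s r {i′ s′ r′} u v → {{v≢0 : ℕ.NonZero v}} →
            numerator i′ s′ r′ ≡ u ℕ.* numerator i s r → denominator i′ s′ r′ ≡ v ℕ.* denominator i s r →
            ι u * γ i s r ≈ ι v * γ i′ s′ r′
  γ-ratio i s r u v {{v≢0}} num≡ den≡ = trans
    (frac-scaled u v (numerator i s r) (denominator i s r)
      {{denominator-nonZero i s r}} {{ℕ.m*n≢0 v _ {{v≢0}} {{denominator-nonZero i s r}}}})
    (reflexive (≡.cong₂ (λ a b → ι v * frac a b) (≡.sym num≡) (≡.sym den≡)))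

  weight-linear : ∀ i s r → let N = 2 ℕ.* (i ℕ.+ s) ℕ.+ e ℕ.+ r in
                  weight i s r ≡ N ℕ.* r ℕ.+ i ℕ.* (e ℕ.+ i) ℕ.+ (N ℕ.+ i) ℕ.* s
  weight-linear i s r = expand e i s r
    where
    expand : ∀ e i s r → (i ℕ.+ s ℕ.+ r) ℕ.* (e ℕ.+ (i ℕ.+ s ℕ.+ s ℕ.+ r))
             ≡ (2 ℕ.* (i ℕ.+ s) ℕ.+ e ℕ.+ r) ℕ.* r ℕ.+ i ℕ.* (e ℕ.+ i) ℕ.+ (2 ℕ.* (i ℕ.+ s) ℕ.+ e ℕ.+ r ℕ.+ i) ℕ.* s
    expand = ℕ-solve-∀

  private
    positive-indices : e ℕ.≤ 1 → ∀ {n} i s r → 2 ℕ.* (i ℕ.+ s) ℕ.+ e ℕ.+ r ≡ suc (suc n) → 0 ℕ.< i ℕ.+ s ℕ.+ r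
    positive-indices _   (suc i) s       r       _     = ℕ.z<s
    positive-indices _   zero    (suc s) r       _     = ℕ.z<s
    positive-indices _   zero    zero    (suc r) _     = ℕ.z<s
    positive-indices e≤1 zero    zero    zero    e≡2+n =
      contradiction (≡.subst (ℕ._≤ 1) (≡.trans (≡.sym (ℕ.+-identityʳ e)) e≡2+n) e≤1) λ { (ℕ.s≤s ()) }

  weight-nonZero : e ℕ.≤ 1 → ∀ {n} i s r → 2 ℕ.* (i ℕ.+ s) ℕ.+ e ℕ.+ r ≡ suc (suc n) → ℕ.NonZero (weight i s r)
  weight-nonZero e≤1 i s r level = ℕ.m*n≢0 _ _ {{ℕ.>-nonZero 0<i+s+r}} {{ℕ.>-nonZero (ℕ.<-≤-trans 0<i+s+r i+s+r≤)}}
    where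
    0<i+s+r : 0 ℕ.< i ℕ.+ s ℕ.+ r
    0<i+s+r = positive-indices e≤1 i s r level
    i+s+r≤ : i ℕ.+ s ℕ.+ r ℕ.≤ e ℕ.+ (i ℕ.+ s ℕ.+ s ℕ.+ r)
    i+s+r≤ = ℕ.≤-trans (ℕ.+-monoˡ-≤ r (ℕ.m≤m+n (i ℕ.+ s) s)) (ℕ.m≤n+m _ e)

  γ-belowʳ : ∀ i s r → ι (weight i s r) * below (γ i s) r ≈ ι r * γ i s r
  γ-belowʳ i s zero    = trans (zeroʳ _) (sym (zeroˡ _))
  γ-belowʳ i s (suc r) =
    γ-ratio i s r {i} {s} {suc r} (weight i s (suc r)) (suc r) (numerator-sucʳ i s r) (denominator-sucʳ i s r)

  γ-belowⁱ : ∀ i s r → ι (weight i s r) * below (λ i → γ i s r) i ≈ ι (i ℕ.* (e ℕ.+ i)) * γ i s r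
  γ-belowⁱ zero    s r = trans (zeroʳ _) (sym (zeroˡ _))
  γ-belowⁱ (suc i) s r = trans
    (γ-ratio i s r {suc i} {s} {r} (weight (suc i) s r) (suc i ℕ.* suc (e ℕ.+ i))
      (numerator-sucⁱ i s r) (denominator-sucⁱ i s r))
    (reflexive (≡.cong (λ m → ι (suc i ℕ.* m) * γ (suc i) s r) (≡.sym (e+suc i))))

  γ-belowˢ : ∀ n i s r → 2 ℕ.* (i ℕ.+ s) ℕ.+ e ℕ.+ r ≡ suc (suc n) →
             ι (weight i s r) * (gap n i * below (λ s → γ i s r) s) ≈ ι (suc (suc n) ℕ.+ i) * ι s * γ i s r
  γ-belowˢ n i zero    r _     = trans (*-congˡ (zeroʳ _)) (trans (zeroʳ _) (sym (trans (*-congʳ (zeroʳ _)) (zeroˡ _))))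
  γ-belowˢ n i (suc s) r level = begin
    ι w * (gap n i * γ i s r)            ≈⟨ *-congˡ (*-congʳ (gap-factor n i q n+1≡i+q)) ⟩
    ι w * (ι M * ι q * γ i s r)          ≈⟨ solve 4 (λ w m q g → w :* (m :* q :* g) := m :* (w :* q :* g)) refl
                                              (ι w) (ι M) (ι q) (γ i s r) ⟩
    ι M * (ι w * ι q * γ i s r)          ≈⟨ *-congˡ (*-congʳ (ι-homo-* w q)) ⟨
    ι M * (ι (w ℕ.* q) * γ i s r)        ≈⟨ *-congˡ (γ-ratio i s r {i} {suc s} {r} (w ℕ.* q) (suc s)
                                                          (numerator-sucˢ i s r) (denominator-sucˢ i s r)) ⟩
    ι M * (ι (suc s) * γ i (suc s) r)    ≈⟨ *-assoc (ι M) (ι (suc s)) _ ⟨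
    ι M * ι (suc s) * γ i (suc s) r      ∎
    where
    w = weight i (suc s) r
    q = suc (e ℕ.+ (i ℕ.+ s ℕ.+ s ℕ.+ r))
    M = suc (suc n) ℕ.+ i
    rearrange : ∀ e i s r → 2 ℕ.* (i ℕ.+ suc s) ℕ.+ e ℕ.+ r ≡ suc (suc (i ℕ.+ (e ℕ.+ (i ℕ.+ s ℕ.+ s ℕ.+ r))))
    rearrange = ℕ-solve-∀
    n+1≡i+q : suc n ≡ i ℕ.+ q
    n+1≡i+q = ≡.trans (ℕ.suc-injective (≡.trans (≡.sym level) (rearrange e i s r))) (≡.sym (ℕ.+-suc i _))

  -- weight i s r is the common denominator of the three neighbour ratios; their numerators r, i (e + i)
  -- and (N + i) s add up to it (weight-linear), which is exactly the contiguity relation.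
  γ-contiguous : e ℕ.≤ 1 → Contiguous e γ
  γ-contiguous e≤1 n i s r level =
    weighted-sum (ι-nonzero (weight i s r) {{weight-nonZero e≤1 i s r level}})
      (γ-belowʳ i s r) (γ-belowⁱ i s r) (γ-belowˢ n i s r level) weight≈
    where
    N = suc (suc n)
    weight≈ : ι (weight i s r) ≈ ι N * ι r + ι (i ℕ.* (e ℕ.+ i)) + ι (N ℕ.+ i) * ι s
    weight≈ = begin
      ι (weight i s r)
        ≡⟨ ≡.cong ι (weight-linear i s r) ⟩
      ι (L ℕ.* r ℕ.+ i ℕ.* (e ℕ.+ i) ℕ.+ (L ℕ.+ i) ℕ.* s)
        ≡⟨ ≡.cong (λ m → ι (m ℕ.* r ℕ.+ i ℕ.* (e ℕ.+ i) ℕ.+ (m ℕ.+ i) ℕ.* s)) level ⟩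
      ι (N ℕ.* r ℕ.+ i ℕ.* (e ℕ.+ i) ℕ.+ (N ℕ.+ i) ℕ.* s)
        ≈⟨ trans (ι-homo-+ (N ℕ.* r ℕ.+ i ℕ.* (e ℕ.+ i)) ((N ℕ.+ i) ℕ.* s))
                 (+-cong (trans (ι-homo-+ (N ℕ.* r) (i ℕ.* (e ℕ.+ i))) (+-congʳ (ι-homo-* N r))) (ι-homo-* (N ℕ.+ i) s)) ⟩
      ι N * ι r + ι (i ℕ.* (e ℕ.+ i)) + ι (N ℕ.+ i) * ι s
        ∎
      where L = 2 ℕ.* (i ℕ.+ s) ℕ.+ e ℕ.+ r

module ExplicitSums {c ℓ} (F : CharZeroField c ℓ) (B Z K : CharZeroField.Carrier F)
                  (K≉0 : ¬ CharZeroField._≈_ F K (CharZeroField.0# F)) (e : ℕ) where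
  open CharZeroField F
  open FieldOps F
  open FieldFacts F
  open FiniteSums F
  open Powers F
  open Coefficients F e using (γ; γ-as-product)
  open TriangularSums F B Z K e γ
  open import Data.Nat using (_!; _∸_)
  open import Relation.Binary.Reasoning.Setoid setoid

  -- P B Z K n is sumTo (n / 2) (row n) for e = 0, and Q B Z K n is (B - 1#) * sumBelow (suc n / 2) (row n)
  -- for e = 1, both definitionally.
  outer : ℕ → ℕ → Carrier
  outer n j = sgn j * pow K (n ∸ j) * pow (Z * K ⁻¹) (n ∸ 2 ℕ.* j ∸ e) * frac ((n ∸ j ∸ e) !) ((n ∸ 2 ℕ.* j ∸ e) !)

  inner : ℕ → ℕ → ℕ → Carrier
  inner n j i = sgn i * frac ((n ∸ i) !) (i ! ℕ.* (e ℕ.+ i) ! ℕ.* (j ∸ i) !) * Λ B i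

  row : ℕ → ℕ → Carrier
  row n j = outer n j * sumTo j (inner n j)

  private
    shape : ℕ → ℕ → ℕ → ℕ → ℕ → ℕ → ℕ → Carrier
    shape j i a r x y s =
      sgn j * pow K a * pow (Z * K ⁻¹) r * frac (x !) (r !) * (sgn i * frac (y !) (i ! ℕ.* (e ℕ.+ i) ! ℕ.* s !) * Λ B i)

    shape-cong : ∀ j i {a r x y s a′ r′ x′ y′ s′} → a ≡ a′ → r ≡ r′ → x ≡ x′ → y ≡ y′ → s ≡ s′ →
                 shape j i a r x y s ≡ shape j i a′ r′ x′ y′ s′
    shape-cong j i ≡.refl ≡.refl ≡.refl ≡.refl ≡.refl = ≡.refl

    ∸-by : ∀ k {m d} → m ≡ k ℕ.+ d → m ∸ k ≡ d
    ∸-by k {d = d} ≡.refl = ℕ.m+n∸m≡n k d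

    regroup : ∀ i s m r f₁ f₂ → sgn (i ℕ.+ s) * pow K (m ℕ.+ r) * pow (Z * K ⁻¹) r * f₁ * (sgn i * f₂ * Λ B i)
                               ≈ f₁ * f₂ * (sgn s * pow Z r * pow K m * Λ B i)
    regroup i s m r f₁ f₂ = begin
      sgn (i ℕ.+ s) * pow K (m ℕ.+ r) * pow (Z * K ⁻¹) r * f₁ * (sgn i * f₂ * Λ B i)
        ≈⟨ *-congʳ (*-congʳ (*-cong (*-cong (sgn-+ i s) (pow-+ K m r)) (pow-* Z (K ⁻¹) r))) ⟩
      sgn i * sgn s * (pow K m * pow K r) * (pow Z r * pow (K ⁻¹) r) * f₁ * (sgn i * f₂ * Λ B i)
        ≈⟨ solve 9 (λ σᵢ σₛ k kʳ z k⁻ʳ f₁ f₂ l → σᵢ :* σₛ :* (k :* kʳ) :* (z :* k⁻ʳ) :* f₁ :* (σᵢ :* f₂ :* l)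
                       := σᵢ :* σᵢ :* (kʳ :* k⁻ʳ) :* (f₁ :* f₂ :* (σₛ :* z :* k :* l)))
             refl (sgn i) (sgn s) (pow K m) (pow K r) (pow Z r) (pow (K ⁻¹) r) f₁ f₂ (Λ B i) ⟩
      sgn i * sgn i * (pow K r * pow (K ⁻¹) r) * (f₁ * f₂ * (sgn s * pow Z r * pow K m * Λ B i))
        ≈⟨ *-congʳ (*-cong (sgn-square i) (pow-inverse K≉0 r)) ⟩
      1# * 1# * (f₁ * f₂ * (sgn s * pow Z r * pow K m * Λ B i))
        ≈⟨ trans (*-congʳ (*-identityˡ 1#)) (*-identityˡ _) ⟩
      f₁ * f₂ * (sgn s * pow Z r * pow K m * Λ B i) ∎

  outer*inner : ∀ n j i s r → j ≡ i ℕ.+ s → n ≡ 2 ℕ.* j ℕ.+ e ℕ.+ r →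
                outer n j * inner n j i ≈ γ i s r * monomial i s r
  outer*inner _ _ i s r ≡.refl ≡.refl = begin
    shape j i (n ∸ j) (n ∸ 2 ℕ.* j ∸ e) (n ∸ j ∸ e) (n ∸ i) (j ∸ i)
      ≡⟨ shape-cong j i n∸j (≡.trans (≡.cong (_∸ e) (∸-by (2 ℕ.* j) (ℕ.+-assoc (2 ℕ.* j) e r))) (ℕ.m+n∸m≡n e r))
                    (≡.trans (≡.cong (_∸ e) n∸j) (∸-by e (split₂ i s e r))) (∸-by i (split₃ i s e r)) (ℕ.m+n∸m≡n i s) ⟩
    shape j i (i ℕ.+ s ℕ.+ e ℕ.+ r) r (i ℕ.+ s ℕ.+ r) (e ℕ.+ (i ℕ.+ s ℕ.+ s ℕ.+ r)) s
      ≈⟨ regroup i s (i ℕ.+ s ℕ.+ e) r _ _ ⟩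
    frac ((i ℕ.+ s ℕ.+ r) !) (r !) * frac ((e ℕ.+ (i ℕ.+ s ℕ.+ s ℕ.+ r)) !) (i ! ℕ.* (e ℕ.+ i) ! ℕ.* s !) * monomial i s r
      ≈⟨ *-congʳ (γ-as-product i s r) ⟨
    γ i s r * monomial i s r ∎
    where
    j = i ℕ.+ s
    n = 2 ℕ.* j ℕ.+ e ℕ.+ r
    split₁ : ∀ i s e r → 2 ℕ.* (i ℕ.+ s) ℕ.+ e ℕ.+ r ≡ i ℕ.+ s ℕ.+ (i ℕ.+ s ℕ.+ e ℕ.+ r)
    split₁ = ℕ-solve-∀
    split₂ : ∀ i s e r → i ℕ.+ s ℕ.+ e ℕ.+ r ≡ e ℕ.+ (i ℕ.+ s ℕ.+ r)
    split₂ = ℕ-solve-∀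
    split₃ : ∀ i s e r → 2 ℕ.* (i ℕ.+ s) ℕ.+ e ℕ.+ r ≡ i ℕ.+ (e ℕ.+ (i ℕ.+ s ℕ.+ s ℕ.+ r))
    split₃ = ℕ-solve-∀
    n∸j : n ∸ j ≡ i ℕ.+ s ℕ.+ e ℕ.+ r
    n∸j = ∸-by j (split₁ i s e r)

  row≈ : ∀ n j → 2 ℕ.* j ℕ.+ e ℕ.≤ n → row n j ≈ sumBelow (suc n) (entry n j)
  row≈ n j 2j+e≤n = begin
    outer n j * sumBelow (suc j) (inner n j)
      ≈⟨ sumBelow-*ˡ (suc j) (outer n j) (inner n j) ⟩
    sumBelow (suc j) (λ i → outer n j * inner n j i)
      ≈⟨ sumBelow-cong (suc j) (λ i i<1+j → outer*inner≈entry i (ℕ.≤-pred i<1+j)) ⟩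
    sumBelow (suc j) (entry n j)
      ≈⟨ sumBelow-extend (entry n j) (ℕ.s≤s j≤n) (entry-vanishesˢ n j) ⟨
    sumBelow (suc n) (entry n j) ∎
    where
    j≤n : j ℕ.≤ n
    j≤n = ℕ.≤-trans (ℕ.m≤n*m j 2) (ℕ.≤-trans (ℕ.m≤m+n (2 ℕ.* j) e) 2j+e≤n)
    outer*inner≈entry : ∀ i → i ℕ.≤ j → outer n j * inner n j i ≈ entry n j i
    outer*inner≈entry i i≤j = trans
      (outer*inner n j i (j ℕ.∸ i) (n ℕ.∸ (2 ℕ.* j ℕ.+ e)) (≡.sym (ℕ.m+[n∸m]≡n i≤j)) (≡.sym (ℕ.m+[n∸m]≡n 2j+e≤n)))
      (reflexive (≡.sym (≡.cong₂ (term i) (∸?-≤ i≤j) (∸?-≤ 2j+e≤n))))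

  rows≈total : ∀ n m → m ℕ.≤ suc n → (∀ j → (j ℕ.< m) ⇔ (2 ℕ.* j ℕ.+ e ℕ.≤ n)) →
               sumBelow m (row n) ≈ total n
  rows≈total n m m≤1+n range = begin
    sumBelow m (row n)
      ≈⟨ sumBelow-cong m (λ j j<m → row≈ n j (Equivalence.to (range j) j<m)) ⟩
    sumBelow m (λ j → sumBelow (suc n) (entry n j))
      ≈⟨ sumBelow-extend _ m≤1+n emptyRow ⟨
    total n ∎
    where
    emptyRow : ∀ j → m ℕ.≤ j → sumBelow (suc n) (entry n j) ≈ 0#
    emptyRow j m≤j = sumBelow-zero (suc n) (λ i _ → entry-vanishesʳ n j i
      (ℕ.≰⇒> (λ 2j+e≤n → ℕ.<⇒≱ (Equivalence.from (range j) 2j+e≤n) m≤j)))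

module ClosedForms {c ℓ} (F : CharZeroField c ℓ) (B Z K : CharZeroField.Carrier F)
                   (K≉0 : ¬ CharZeroField._≈_ F K (CharZeroField.0# F)) where
  open CharZeroField F
  open FieldOps F
  open FieldFacts F
  open ThreeTermRecurrences F
  open import Data.Integer using (+_)
  open import Relation.Binary.Reasoning.Setoid setoid

  zCoefficient kCoefficient : ℕ → Carrier
  zCoefficient n = Z * ι (suc (suc n))
  kCoefficient n = K * (B - ι (suc (suc n))) * (B + ι (suc n))

  P-threeTerm : ThreeTerm zCoefficient kCoefficient (P B Z K)
  P-threeTerm = threeTerm-cong P≈total (total-threeTerm (γ-contiguous ℕ.z≤n))
    where
    open Coefficients F 0 using (γ; γ-contiguous)
    open TriangularSums F B Z K 0 γ using (total; total-threeTerm)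
    P≈total : ∀ n → P B Z K n ≈ total n
    P≈total n = ExplicitSums.rows≈total F B Z K K≉0 0 n (suc (n ℕ./ 2)) (ℕ.s≤s (ℕ.m/n≤m n 2)) (j<1+n/2⇔ n)

  Q-threeTerm : ThreeTerm zCoefficient kCoefficient (Q B Z K)
  Q-threeTerm = threeTerm-cong Q≈total (threeTerm-*ˡ (B - 1#) (total-threeTerm (γ-contiguous ℕ.≤-refl)))
    where
    open Coefficients F 1 using (γ; γ-contiguous)
    open TriangularSums F B Z K 1 γ using (total; total-threeTerm)
    Q≈total : ∀ n → Q B Z K n ≈ (B - 1#) * total n
    Q≈total n = *-congˡ (ExplicitSums.rows≈total F B Z K K≉0 1 n (suc n ℕ./ 2) (ℕ.m/n≤m (suc n) 2) (j<[1+n]/2⇔ n))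

  private
    frac-1-1 : frac 1 1 ≈ 1#
    frac-1-1 = sym (frac-unique 1 1 (*-identityˡ (ι 1)))

  -- For n ≤ 1 only the summand j = i = 0 is present, and both of its fractions are frac 1 1.
  P₀ : P B Z K 0 ≈ 1#
  P₀ = trans (solve 1 (λ f → con (+ 0) :+ con (+ 1) :* con (+ 1) :* con (+ 1) :* f
                                :* (con (+ 0) :+ con (+ 1) :* f :* (con (+ 1) :* con (+ 1))) := f :* f) refl (frac 1 1))
             (trans (*-cong frac-1-1 frac-1-1) (*-identityˡ 1#))

  P₁ : P B Z K 1 ≈ Z
  P₁ = begin
    P B Z K 1
      ≈⟨ solve 4 (λ k z k⁻¹ f → con (+ 0) :+ con (+ 1) :* (con (+ 1) :* k) :* (con (+ 1) :* (z :* k⁻¹)) :* f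
                                  :* (con (+ 0) :+ con (+ 1) :* f :* (con (+ 1) :* con (+ 1)))
                                := k :* k⁻¹ :* (f :* f) :* z) refl K Z (K ⁻¹) (frac 1 1) ⟩
    K * K ⁻¹ * (frac 1 1 * frac 1 1) * Z
      ≈⟨ *-congʳ (*-cong (inverse K K≉0) (trans (*-cong frac-1-1 frac-1-1) (*-identityˡ 1#))) ⟩
    1# * 1# * Z
      ≈⟨ trans (*-congʳ (*-identityˡ 1#)) (*-identityˡ Z) ⟩
    Z ∎

  Q₀ : Q B Z K 0 ≈ 0#
  Q₀ = zeroʳ (B - 1#)

  Q₁ : Q B Z K 1 ≈ (B - 1#) * K
  Q₁ = begin
    Q B Z K 1
      ≈⟨ solve 3 (λ b k f → b :* (con (+ 0) :+ con (+ 1) :* (con (+ 1) :* k) :* con (+ 1) :* f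
                                  :* (con (+ 0) :+ con (+ 1) :* f :* (con (+ 1) :* con (+ 1))))
                            := b :* k :* (f :* f)) refl (B - 1#) K (frac 1 1) ⟩
    (B - 1#) * K * (frac 1 1 * frac 1 1)
      ≈⟨ *-congˡ (trans (*-cong frac-1-1 frac-1-1) (*-identityˡ 1#)) ⟩
    (B - 1#) * K * 1#
      ≈⟨ *-identityʳ _ ⟩
    (B - 1#) * K ∎

  module _ (v : ℕ → Carrier)
           (v-rec : ∀ m → (ι (suc m) + B) * v (suc (suc m)) ≈ Z * ι (suc m) * v (suc m) + K * (B - ι (suc m)) * v m)
           where

    scaled₀ : poch (B + 1#) 0 * v 1 ≈ P B Z K 0 * v 1 + Q B Z K 0 * v 0
    scaled₀ = sym (trans (+-cong (*-congʳ P₀) (*-congʳ Q₀)) (trans (+-congˡ (zeroˡ (v 0))) (+-identityʳ _)))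

    scaled₁ : poch (B + 1#) 1 * v 2 ≈ P B Z K 1 * v 1 + Q B Z K 1 * v 0
    scaled₁ = begin
      1# * (B + 1# + 0#) * v 2
        ≈⟨ solve 2 (λ b w → con (+ 1) :* (b :+ con (+ 1) :+ con (+ 0)) :* w := (con (+ 1) :+ con (+ 0) :+ b) :* w) refl B (v 2) ⟩
      (ι 1 + B) * v 2
        ≈⟨ v-rec 0 ⟩
      Z * ι 1 * v 1 + K * (B - ι 1) * v 0
        ≈⟨ solve 5 (λ z k b x y → z :* (con (+ 1) :+ con (+ 0)) :* x :+ k :* (b :- (con (+ 1) :+ con (+ 0))) :* y
                                  := z :* x :+ (b :- con (+ 1)) :* k :* y) refl Z K B (v 1) (v 0) ⟩
      Z * v 1 + (B - 1#) * K * v 0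
        ≈⟨ +-cong (*-congʳ P₁) (*-congʳ Q₁) ⟨
      P B Z K 1 * v 1 + Q B Z K 1 * v 0 ∎

    scaled-threeTerm : ThreeTerm zCoefficient kCoefficient (λ n → poch (B + 1#) n * v (suc n))
    scaled-threeTerm n = begin
      poch (B + 1#) (suc n) * (B + 1# + ι (suc n)) * v (3 ℕ.+ n)
        ≈⟨ solve 4 (λ q b a w → q :* (b :+ con (+ 1) :+ a) :* w := q :* ((con (+ 1) :+ a :+ b) :* w)) refl
             (poch (B + 1#) (suc n)) B (ι (suc n)) (v (3 ℕ.+ n)) ⟩
      poch (B + 1#) (suc n) * ((ι (2 ℕ.+ n) + B) * v (3 ℕ.+ n))
        ≈⟨ *-congˡ (v-rec (suc n)) ⟩
      poch (B + 1#) n * (B + 1# + ι n) * (Z * ι (2 ℕ.+ n) * v (2 ℕ.+ n) + K * (B - ι (2 ℕ.+ n)) * v (suc n))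
        ≈⟨ solve 7 (λ r b a z k w₂ w₁ →
               r :* (b :+ con (+ 1) :+ a) :* (z :* (con (+ 1) :+ (con (+ 1) :+ a)) :* w₂
                                               :+ k :* (b :- (con (+ 1) :+ (con (+ 1) :+ a))) :* w₁)
             := z :* (con (+ 1) :+ (con (+ 1) :+ a)) :* (r :* (b :+ con (+ 1) :+ a) :* w₂)
                :+ k :* (b :- (con (+ 1) :+ (con (+ 1) :+ a))) :* (b :+ (con (+ 1) :+ a)) :* (r :* w₁))
             refl (poch (B + 1#) n) B (ι n) Z K (v (2 ℕ.+ n)) (v (suc n)) ⟩
      zCoefficient n * (poch (B + 1#) (suc n) * v (2 ℕ.+ n)) + kCoefficient n * (poch (B + 1#) n * v (suc n)) ∎


theorem8p1 : ∀ {c ℓ : Level} (F : CharZeroField c ℓ) →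
    let open CharZeroField F in
    let open FieldOps F in
    ∀ (B Z K : Carrier) (v : ℕ → Carrier) →
    ¬ (K ≈ 0#) →
    (∀ m → ¬ (B + ι (suc m) ≈ 0#)) →
    (∀ m → (ι (suc m) + B) * v (suc (suc m))
             ≈ Z * ι (suc m) * v (suc m) + K * (B - ι (suc m)) * v m) →
    ∀ n → v (suc n) ≈ P B Z K n * (poch (B + 1#) n) ⁻¹ * v 1
                      + Q B Z K n * (poch (B + 1#) n) ⁻¹ * v 0
theorem8p1 F B Z K v K≉0 B+m≉0 v-rec n = begin
  v (suc n)                                        ≈⟨ *-identityˡ _ ⟨
  1# * v (suc n)                                   ≈⟨ *-congʳ (⁻¹-inverseˡ p≉0) ⟨
  p ⁻¹ * p * v (suc n)                             ≈⟨ *-assoc (p ⁻¹) p (v (suc n)) ⟩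
  p ⁻¹ * (p * v (suc n))                           ≈⟨ *-congˡ (threeTerm-span (v 1) (v 0) P-threeTerm Q-threeTerm
                                                        (scaled-threeTerm v v-rec) (scaled₀ v v-rec) (scaled₁ v v-rec) n) ⟩
  p ⁻¹ * (P B Z K n * v 1 + Q B Z K n * v 0)       ≈⟨ solve 5 (λ p⁻¹ x v₁ y v₀ → p⁻¹ :* (x :* v₁ :+ y :* v₀)
                                                                          := x :* p⁻¹ :* v₁ :+ y :* p⁻¹ :* v₀)
                                                        refl (p ⁻¹) (P B Z K n) (v 1) (Q B Z K n) (v 0) ⟩
  P B Z K n * p ⁻¹ * v 1 + Q B Z K n * p ⁻¹ * v 0  ∎
  where
  open CharZeroField F
  open FieldOps F
  open FieldFacts F
  open Powers F using (poch-nonzero)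
  open ThreeTermRecurrences F using (threeTerm-span)
  open ClosedForms F B Z K K≉0
  open import Relation.Binary.Reasoning.Setoid setoid
  p : Carrier
  p = poch (B + 1#) n
  p≉0 : ¬ p ≈ 0#
  p≉0 = poch-nonzero n (λ m _ B+1+m≈0 → B+m≉0 m (trans (sym (+-assoc B 1# (ι m))) B+1+m≈0))
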